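{- Let $\bar{a}(N)$ denote the number of partitions $\lambda$ of $N$ with at least two parts, no parts of size $1$, and $\lambda_1=\lambda_2$. For every $j\in\mathbb{N}$ and every integer $n\ge 2j+2$, $$PM(2n-j,n-j)-PM(2(n-1)-j,(n-1)-j)=\bar{a}(n+1).$$
   Context: A partition $\lambda=(\lambda_1\ge\cdots\ge\lambda_\ell)$ of $n$ is a finite nonincreasing sequence of positive integers with sum $n$; $\ell(\lambda)$ is its number of parts. The hook length $h_{(i,j)}(\lambda)$ of a cell $(i,j)$ of the Ferrers diagram is the number of cells consisting of the cell itself, the cells to its right in its row and the cells below it in its column. A numerical set is a subset $S\subseteq\mathbb{N}_0$ containing $0$ with finite complement; a numerical semigroup is a numerical set closed under addition. For a partition $\lambda$ let $S_\lambda=\mathbb{N}_0\setminus\{h_{(i,1)}(\lambda):1\le i\le\ell(\lambda)\}$. $PM(n,m)$ is the number of partitions $\lambda$ of $n$ having exactly $m-1$ parts equal to $1$ such that $S_\lambda$ is a numerical semigroup. Here $\mathbb{N}$ is as written in the paper, which applies the case $j=0$. -}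

module Defs where

open import Data.Nat using (ℕ; zero; suc; _+_; _∸_; _≤_; _≥_; _≟_)
open import Data.List using (List; []; _∷_; length; filter)
open import Data.Nat.ListAction using (sum)
open import Data.List.Relation.Unary.All using (All)
open import Data.List.Relation.Unary.Linked using (Linked)
open import Data.List.Relation.Unary.Unique.Propositional using (Unique)
open import Data.List.Membership.Propositional using (_∈_)
open import Data.Product using (Σ; _×_; ∃)
open import Relation.Binary.PropositionalEquality using (_≡_)
open import Relation.Nullary using (¬_)
open import Data.Empty using (⊥)
open import Function.Bundles using (_⇔_)

IsPartition : ℕ → List ℕ → Set
IsPartition n λs = All (1 ≤_) λs × Linked _≥_ λs × sum λs ≡ n

-- Hook lengths of the first-column cells (i,1), i = 1..ℓ:
-- h_(i,1) = (arm) + (leg) + 1 = (λᵢ - 1) + (ℓ - i) + 1 = λᵢ + (ℓ - i).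
-- For λ = x ∷ xs (row i = head), ℓ - i = length xs.
firstColHooks : List ℕ → List ℕ
firstColHooks []       = []
firstColHooks (x ∷ xs) = (x + length xs) ∷ firstColHooks xs

_∈S[_] : ℕ → List ℕ → Set
x ∈S[ λs ] = ¬ (x ∈ firstColHooks λs)

IsNumericalSemigroup : (ℕ → Set) → Set
IsNumericalSemigroup S =
  S 0 ×
  (∃ λ b → ∀ x → b ≤ x → S x) ×
  (∀ x y → S x → S y → S (x + y))

onesCount : List ℕ → ℕ
onesCount λs = length (filter (_≟ 1) λs)

PMPred : ℕ → ℕ → List ℕ → Set
PMPred n m λs =
  IsPartition n λs × onesCount λs ≡ m ∸ 1 × IsNumericalSemigroup (λ x → x ∈S[ λs ])

FirstTwoEqual : List ℕ → Set
FirstTwoEqual []            = ⊥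
FirstTwoEqual (x ∷ [])      = ⊥
FirstTwoEqual (x ∷ y ∷ _)   = x ≡ y

AbarPred : ℕ → List ℕ → Set
AbarPred N λs =
  IsPartition N λs × 2 ≤ length λs × All (2 ≤_) λs × FirstTwoEqual λs

HasCount : (List ℕ → Set) → ℕ → Set
HasCount P k =
  Σ (List (List ℕ)) λ L → Unique L × (∀ x → (x ∈ L) ⇔ P x) × length L ≡ k

-- Write λ = μ ++ 1^r with all parts of μ at least 2. The first-column hooks of λ are 1, …, r,
-- the hooks of μ shifted by r, and the corner hook t. When |μ| ≤ 2r + 2 every hook other than t
-- is at most 2r + 1, while two positive elements of S_λ exceed r, so S_λ is a semigroup exactly
-- when t is not a sum of two positive elements of S_λ. That condition is unchanged when one cell
-- is added to the first row and one to the first column, so this operation maps the partitions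
-- counted by PM(2(n-1)-j, n-1-j) injectively into those counted by PM(2n-j, n-j). Its image
-- misses precisely the partitions whose non-one part μ has μ₁ = μ₂; these are semigroup
-- partitions automatically (then t ≤ 2r + 1) and are counted by ā(n+1).
module Submission where

open import Defs
open import Data.Nat using (ℕ; zero; suc; _+_; _*_; _∸_; _≤_; _<_; _≥_; z≤n; s≤s; _≟_)
open import Data.Nat.Properties
open import Data.Nat.ListAction using (sum)
open import Data.Nat.ListAction.Properties using (sum-++)
open import Data.Nat.Solver using (module +-*-Solver)
open import Data.List using (List; []; _∷_; [_]; _++_; _∷ʳ_; length; filter; map; replicate)
open import Data.List.Properties
  using (length-++; length-map; length-replicate; ++-assoc; ++-cancelʳ; ∷ʳ-injectiveˡ;
         map-cong; filter-++; filter-all; filter-none)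
open import Data.List.Relation.Unary.All as All using (All; []; _∷_)
open import Data.List.Relation.Unary.All.Properties using (++⁺; replicate⁺)
open import Data.List.Relation.Unary.Any using (here; there)
open import Data.List.Relation.Unary.Linked as Linked using (Linked; []; [-]; _∷_)
open import Data.List.Relation.Unary.Unique.Propositional using (Unique)
import Data.List.Relation.Unary.Unique.Propositional.Properties as Unique
open import Data.List.Relation.Binary.Disjoint.Propositional using (Disjoint)
open import Data.List.Relation.Binary.BagAndSetEquality using (∼bag⇒↭)
open import Data.List.Relation.Binary.Permutation.Propositional.Properties using (↭-length)
open import Data.List.Membership.Propositional using (_∈_)
open import Data.List.Membership.Propositional.Properties
  using (∈-map⁺; ∈-map⁻; ∈-++⁺ˡ; ∈-++⁺ʳ; ∈-++⁻)
open import Data.List.Membership.Propositional.Properties.WithK using (unique∧set⇒bag)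
open import Data.Product using (∃; ∃₂; _×_; _,_; proj₂)
open import Data.Sum using (_⊎_; inj₁; inj₂)
open import Function using (_∘_)
open import Function.Bundles using (_⇔_; mk⇔; Equivalence)
open import Function.Construct.Composition using (_⇔-∘_)
open import Function.Construct.Symmetry using (⇔-sym)
open import Relation.Binary.PropositionalEquality
  using (_≡_; _≢_; refl; sym; trans; cong; cong₂; subst; subst₂; module ≡-Reasoning)
open import Relation.Nullary using (¬_; yes; no; contradiction)

ones : ℕ → List ℕ
ones r = replicate r 1

ones-∷ʳ : ∀ r → ones r ∷ʳ 1 ≡ ones (suc r)
ones-∷ʳ zero    = refl
ones-∷ʳ (suc r) = cong (1 ∷_) (ones-∷ʳ r)

++-ones-∷ʳ : ∀ ys r → (ys ++ ones r) ∷ʳ 1 ≡ ys ++ ones (suc r)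
++-ones-∷ʳ ys r = trans (++-assoc ys (ones r) [ 1 ]) (cong (ys ++_) (ones-∷ʳ r))

sum-ones : ∀ r → sum (ones r) ≡ r
sum-ones zero    = refl
sum-ones (suc r) = cong suc (sum-ones r)

sum-++-ones : ∀ μ r → sum (μ ++ ones r) ≡ sum μ + r
sum-++-ones μ r = trans (sum-++ μ (ones r)) (cong (sum μ +_) (sum-ones r))

length-++-ones : ∀ ys r → length (ys ++ ones r) ≡ length ys + r
length-++-ones ys r = trans (length-++ ys) (cong (length ys +_) (length-replicate r))

m<n∧m<o⇒1+m+m<n+o : ∀ {m n o} → m < n → m < o → suc (m + m) < n + o
m<n∧m<o⇒1+m+m<n+o {m} m<n m<o = ≤-trans (≤-reflexive (cong suc (sym (+-suc m m)))) (+-mono-≤ m<n m<o)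

h+h≤1+m+m⇒h≤m : ∀ {h m} → h + h ≤ suc (m + m) → h ≤ m
h+h≤1+m+m⇒h≤m h+h≤ = ≮⇒≥ λ m<h → <⇒≱ (m<n∧m<o⇒1+m+m<n+o m<h m<h) h+h≤

*-length≤sum : ∀ {k xs} → All (k ≤_) xs → k * length xs ≤ sum xs
*-length≤sum {k} []                = ≤-reflexive (*-zeroʳ k)
*-length≤sum {k} {_ ∷ xs} (p ∷ ps) =
  ≤-trans (≤-reflexive (*-suc k (length xs))) (+-mono-≤ p (*-length≤sum ps))

length-unique-≡ : ∀ {A : Set} {xs ys : List A} → Unique xs → Unique ys →
                  (∀ {z} → z ∈ xs ⇔ z ∈ ys) → length xs ≡ length ys
length-unique-≡ xs! ys! same = ↭-length (∼bag⇒↭ (unique∧set⇒bag xs! ys! same))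

count-disjointUnion : ∀ {P Q R : List ℕ → Set} {f g : List ℕ → List ℕ} {a b c} →
  (∀ {x y} → f x ≡ f y → x ≡ y) → (∀ {x y} → g x ≡ g y → x ≡ y) →
  (∀ {x y} → Q x → R y → f x ≢ g y) →
  (∀ {x} → Q x → P (f x)) → (∀ {y} → R y → P (g y)) →
  (∀ {z} → P z → (∃ λ x → Q x × z ≡ f x) ⊎ (∃ λ y → R y × z ≡ g y)) →
  HasCount P a → HasCount Q b → HasCount R c → a ≡ b + c
count-disjointUnion {P} {Q} {R} {f} {g} f-inj g-inj disjoint Q⇒P R⇒P P⇒
  (LP , LP! , LP≡ , refl) (LQ , LQ! , LQ≡ , refl) (LR , LR! , LR≡ , refl) = begin
    length LP                              ≡⟨ length-unique-≡ LP! images! (mk⇔ into outof) ⟩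
    length (map f LQ ++ map g LR)          ≡⟨ length-++ (map f LQ) ⟩
    length (map f LQ) + length (map g LR)  ≡⟨ cong₂ _+_ (length-map f LQ) (length-map g LR) ⟩
    length LQ + length LR                  ∎
  where
  open ≡-Reasoning
  images-disjoint : Disjoint (map f LQ) (map g LR)
  images-disjoint (fx∈ , gy∈) with ∈-map⁻ f fx∈ | ∈-map⁻ g gy∈
  ... | x , x∈ , refl | y , y∈ , fx≡gy =
    disjoint (Equivalence.to (LQ≡ x) x∈) (Equivalence.to (LR≡ y) y∈) fx≡gy
  images! : Unique (map f LQ ++ map g LR)
  images! = Unique.++⁺ (Unique.map⁺ f-inj LQ!) (Unique.map⁺ g-inj LR!) images-disjoint
  into : ∀ {z} → z ∈ LP → z ∈ map f LQ ++ map g LR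
  into {z} z∈ with P⇒ (Equivalence.to (LP≡ z) z∈)
  ... | inj₁ (x , Qx , refl) = ∈-++⁺ˡ (∈-map⁺ f (Equivalence.from (LQ≡ x) Qx))
  ... | inj₂ (y , Ry , refl) = ∈-++⁺ʳ (map f LQ) (∈-map⁺ g (Equivalence.from (LR≡ y) Ry))
  outof : ∀ {z} → z ∈ map f LQ ++ map g LR → z ∈ LP
  outof z∈ with ∈-++⁻ (map f LQ) z∈
  ... | inj₁ fx∈ with ∈-map⁻ f fx∈
  ...   | x , x∈ , refl = Equivalence.from (LP≡ _) (Q⇒P (Equivalence.to (LQ≡ x) x∈))
  outof z∈ | inj₂ gy∈ with ∈-map⁻ g gy∈
  ...   | y , y∈ , refl = Equivalence.from (LP≡ _) (R⇒P (Equivalence.to (LR≡ y) y∈))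

OnesFreePartition : ℕ → List ℕ → Set
OnesFreePartition N μ = All (2 ≤_) μ × Linked _≥_ μ × sum μ ≡ N

All-++-ones : ∀ {μ} r → All (2 ≤_) μ → All (1 ≤_) (μ ++ ones r)
All-++-ones r ps = ++⁺ (All.map <⇒≤ ps) (replicate⁺ r ≤-refl)

Linked-ones : ∀ r → Linked _≥_ (ones r)
Linked-ones zero          = []
Linked-ones (suc zero)    = [-]
Linked-ones (suc (suc r)) = ≤-refl ∷ Linked-ones (suc r)

Linked-++-ones : ∀ {μ} r → All (2 ≤_) μ → Linked _≥_ μ → Linked _≥_ (μ ++ ones r)
Linked-++-ones r       []            []        = Linked-ones r
Linked-++-ones zero    (_ ∷ [])      [-]       = [-]
Linked-++-ones (suc r) (2≤x ∷ [])    [-]       = <⇒≤ 2≤x ∷ Linked-ones (suc r)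
Linked-++-ones r       (_ ∷ p ∷ ps) (x≥y ∷ lk) = x≥y ∷ Linked-++-ones r (p ∷ ps) lk

onesCount-++-ones : ∀ {μ} r → All (2 ≤_) μ → onesCount (μ ++ ones r) ≡ r
onesCount-++-ones {μ} r ps = begin
  length (filter (_≟ 1) (μ ++ ones r))                   ≡⟨ cong length (filter-++ (_≟ 1) μ (ones r)) ⟩
  length (filter (_≟ 1) μ ++ filter (_≟ 1) (ones r))     ≡⟨ cong₂ (λ as bs → length (as ++ bs))
                                                              (filter-none (_≟ 1) (All.map >⇒≢ ps))
                                                              (filter-all (_≟ 1) (replicate⁺ r refl)) ⟩
  length (ones r)                                        ≡⟨ length-replicate r ⟩
  r                                                      ∎
  where open ≡-Reasoning

splitOnes : ∀ {λs} → All (1 ≤_) λs → Linked _≥_ λs →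
            ∃₂ λ μ k → All (2 ≤_) μ × Linked _≥_ μ × λs ≡ μ ++ ones k
splitOnes [] [] = [] , 0 , [] , [] , refl
splitOnes {x ∷ _} (1≤x ∷ pos) lk with splitOnes pos (Linked.tail lk)
... | y ∷ μ , k , 2≤y ∷ ps , lkμ , refl =
  x ∷ y ∷ μ , k , ≤-trans 2≤y (Linked.head lk) ∷ 2≤y ∷ ps , Linked.head lk ∷ lkμ , refl
... | [] , k , [] , [] , refl with x ≟ 1
...   | yes refl = [] , suc k , [] , [] , refl
...   | no x≢1   = [ x ] , k , ≤∧≢⇒< 1≤x (x≢1 ∘ sym) ∷ [] , [-] , refl

IsSemigroupPartition : List ℕ → Set
IsSemigroupPartition λs = IsNumericalSemigroup (_∈S[ λs ])

PMPred⇒onesSplit : ∀ {N r λs} → PMPred (N + r) (suc r) λs →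
                   ∃ λ μ → OnesFreePartition N μ × λs ≡ μ ++ ones r
PMPred⇒onesSplit {N} {r} ((pos , lk , sum≡) , count≡ , _) with splitOnes pos lk
... | μ , k , ps , lkμ , refl with trans (sym (onesCount-++-ones k ps)) count≡
...   | refl = μ , (ps , lkμ , +-cancelʳ-≡ r (sum μ) N (trans (sym (sum-++-ones μ r)) sum≡)) , refl

onesSplit⇒PMPred : ∀ {N r μ} → OnesFreePartition N μ → IsSemigroupPartition (μ ++ ones r) →
                   PMPred (N + r) (suc r) (μ ++ ones r)
onesSplit⇒PMPred {r = r} {μ} (ps , lk , refl) S =
  (All-++-ones r ps , Linked-++-ones r ps lk , sum-++-ones μ r) , onesCount-++-ones r ps , S

-- First-column hooks

firstColHooks-++ : ∀ xs ys →
  firstColHooks (xs ++ ys) ≡ map (_+ length ys) (firstColHooks xs) ++ firstColHooks ys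
firstColHooks-++ []       ys = refl
firstColHooks-++ (x ∷ xs) ys =
  cong₂ _∷_ (trans (cong (x +_) (length-++ xs)) (sym (+-assoc x _ _))) (firstColHooks-++ xs ys)

firstColHooks-∷ʳ : ∀ xs → firstColHooks (xs ∷ʳ 1) ≡ map suc (firstColHooks xs) ∷ʳ 1
firstColHooks-∷ʳ xs =
  trans (firstColHooks-++ xs [ 1 ]) (cong (_∷ʳ 1) (map-cong (λ z → +-comm z 1) (firstColHooks xs)))

∈-firstColHooks-ones⁺ : ∀ {r z} → 1 ≤ z → z ≤ r → z ∈ firstColHooks (ones r)
∈-firstColHooks-ones⁺ {zero}  1≤z z≤0 = contradiction (≤-trans 1≤z z≤0) λ ()
∈-firstColHooks-ones⁺ {suc r} {z} 1≤z z≤1+r with z ≟ suc r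
... | yes refl rewrite length-replicate r {1} = here refl
... | no z≢1+r = there (∈-firstColHooks-ones⁺ 1≤z (≤-pred (≤∧≢⇒< z≤1+r z≢1+r)))

∈-firstColHooks-ones⁻ : ∀ {r z} → z ∈ firstColHooks (ones r) → z ≤ r
∈-firstColHooks-ones⁻ {suc r} (here refl) = ≤-reflexive (cong suc (length-replicate r))
∈-firstColHooks-ones⁻ {suc r} (there z∈)  = m≤n⇒m≤1+n (∈-firstColHooks-ones⁻ z∈)

firstColHooks-positive : ∀ {λs z} → All (1 ≤_) λs → z ∈ firstColHooks λs → 1 ≤ z
firstColHooks-positive {x ∷ _} (1≤x ∷ _) (here refl) = ≤-trans 1≤x (m≤m+n x _)
firstColHooks-positive         (_ ∷ ps)  (there z∈)  = firstColHooks-positive ps z∈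

firstColHook≤sum : ∀ {λs z} → All (1 ≤_) λs → z ∈ firstColHooks λs → z ≤ sum λs
firstColHook≤sum {x ∷ xs} (_ ∷ ps) (here refl) =
  +-monoʳ-≤ x (≤-trans (≤-reflexive (sym (*-identityˡ (length xs)))) (*-length≤sum ps))
firstColHook≤sum {x ∷ _}  (_ ∷ ps) (there z∈)  = ≤-trans (firstColHook≤sum ps z∈) (m≤n+m _ x)

firstColHook-double≤ : ∀ {c ys h} → Linked _≥_ (c ∷ ys) → All (2 ≤_) ys →
                       h ∈ firstColHooks ys → h + h ≤ c + sum ys
firstColHook-double≤ {c} {y ∷ ys} (y≤c ∷ _) (_ ∷ ps) (here refl) = begin
  (y + length ys) + (y + length ys)  ≡⟨ solve 2 (λ y l → (y :+ l) :+ (y :+ l) := y :+ (y :+ con 2 :* l))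
                                                refl y (length ys) ⟩
  y + (y + 2 * length ys)            ≤⟨ +-mono-≤ y≤c (+-monoʳ-≤ y (*-length≤sum ps)) ⟩
  c + (y + sum ys)                   ∎
  where open ≤-Reasoning
        open +-*-Solver
firstColHook-double≤ {c} {y ∷ _} (_ ∷ lk) (_ ∷ ps) (there h∈) =
  ≤-trans (firstColHook-double≤ lk ps h∈) (m≤n+m _ c)

-- When S_λ is a numerical semigroup

Indecomposable : List ℕ → ℕ → Set
Indecomposable λs t = ∀ u v → 1 ≤ u → 1 ≤ v → u ∈S[ λs ] → v ∈S[ λs ] → u + v ≢ t

semigroup⇒indecomposable : ∀ {λs t} → IsSemigroupPartition λs → t ∈ firstColHooks λs →
                           Indecomposable λs t
semigroup⇒indecomposable (_ , _ , closed) t∈ u v _ _ u∈S v∈S refl = closed u v u∈S v∈S t∈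

positiveElement>r : ∀ {λs r u} → (∀ {z} → 1 ≤ z → z ≤ r → z ∈ firstColHooks λs) →
                    1 ≤ u → u ∈S[ λs ] → r < u
positiveElement>r gaps 1≤u u∈S = ≰⇒> λ u≤r → u∈S (gaps 1≤u u≤r)

semigroup-criterion : ∀ {λs r t} → All (1 ≤_) λs →
  (∀ {z} → 1 ≤ z → z ≤ r → z ∈ firstColHooks λs) →
  (∀ {z} → z ∈ firstColHooks λs → z ≡ t ⊎ z ≤ suc (r + r)) →
  Indecomposable λs t → IsSemigroupPartition λs
semigroup-criterion {λs} pos gaps bounded indec =
  (n≮0 ∘ firstColHooks-positive pos) ,
  (suc (sum λs) , λ _ sum<x z∈ → <⇒≱ sum<x (firstColHook≤sum pos z∈)) ,
  closed
  where
  closed : ∀ u v → u ∈S[ λs ] → v ∈S[ λs ] → (u + v) ∈S[ λs ]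
  closed zero    v    _   v∈S = v∈S
  closed (suc u) zero u∈S _   = subst (_∈S[ λs ]) (sym (+-identityʳ (suc u))) u∈S
  closed (suc u) (suc v) u∈S v∈S z∈ with bounded z∈
  ... | inj₁ u+v≡t = indec (suc u) (suc v) (s≤s z≤n) (s≤s z≤n) u∈S v∈S u+v≡t
  ... | inj₂ u+v≤ = <⇒≱ (m<n∧m<o⇒1+m+m<n+o (positiveElement>r gaps (s≤s z≤n) u∈S)
                                             (positiveElement>r gaps (s≤s z≤n) v∈S)) u+v≤

ones-gaps : ∀ x ys r {z} → 1 ≤ z → z ≤ r → z ∈ firstColHooks (x ∷ ys ++ ones r)
ones-gaps _ ys r 1≤z z≤r =
  there (subst (_ ∈_) (sym (firstColHooks-++ ys (ones r))) (∈-++⁺ʳ _ (∈-firstColHooks-ones⁺ 1≤z z≤r)))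

gaps-bounded : ∀ {N x ys r z} → OnesFreePartition N (x ∷ ys) → N ≤ suc (suc (r + r)) →
               z ∈ firstColHooks (x ∷ ys ++ ones r) → z ≡ x + length (ys ++ ones r) ⊎ z ≤ suc (r + r)
gaps-bounded _ _ (here z≡t) = inj₁ z≡t
gaps-bounded {x = x} {ys} {r} (_ ∷ ps , lk , refl) N≤ (there z∈)
  with ∈-++⁻ _ (subst (_ ∈_) (firstColHooks-++ ys (ones r)) z∈)
... | inj₂ z∈ones = inj₂ (≤-trans (∈-firstColHooks-ones⁻ z∈ones) (≤-trans (m≤m+n r r) (n≤1+n _)))
... | inj₁ z∈shifted with ∈-map⁻ (_+ length (ones r)) z∈shifted
...   | h , h∈ , refl = inj₂ (+-mono-≤ h≤1+r (≤-reflexive (length-replicate r)))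
  where
  h≤1+r : h ≤ suc r
  h≤1+r = h+h≤1+m+m⇒h≤m (≤-trans (firstColHook-double≤ lk ps h∈)
                                  (≤-trans N≤ (s≤s (s≤s (+-monoʳ-≤ r (n≤1+n r))))))

isSemigroup⇔indecomposable : ∀ {N x ys r} → OnesFreePartition N (x ∷ ys) → N ≤ suc (suc (r + r)) →
  IsSemigroupPartition (x ∷ ys ++ ones r) ⇔ Indecomposable (x ∷ ys ++ ones r) (x + length (ys ++ ones r))
isSemigroup⇔indecomposable {x = x} {ys} {r} μ-part@(ps , _ , _) N≤ = mk⇔
  (λ S → semigroup⇒indecomposable S (here refl))
  (semigroup-criterion (All-++-ones r ps) (ones-gaps x ys r) (gaps-bounded μ-part N≤))

doubledHead-isSemigroup : ∀ {N x ys r} → OnesFreePartition N (x ∷ x ∷ ys) → N ≤ suc (r + r) →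
                          IsSemigroupPartition (x ∷ x ∷ ys ++ ones r)
doubledHead-isSemigroup {x = x} {ys} {r} μ-part@(_ ∷ ps , lk , refl) N≤ =
  Equivalence.from (isSemigroup⇔indecomposable {r = r} μ-part (≤-trans N≤ (n≤1+n _))) indecomposable
  where
  x+len≤r : x + length ys ≤ r
  x+len≤r = h+h≤1+m+m⇒h≤m (≤-trans (firstColHook-double≤ lk ps (here refl)) N≤)
  t≤ : x + length (x ∷ ys ++ ones r) ≤ suc (r + r)
  t≤ = begin
    x + suc (length (ys ++ ones r)) ≡⟨ +-suc x _ ⟩
    suc (x + length (ys ++ ones r)) ≡⟨ cong (λ l → suc (x + l)) (length-++-ones ys r) ⟩
    suc (x + (length ys + r))       ≡⟨ cong suc (+-assoc x (length ys) r) ⟨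
    suc (x + length ys + r)         ≤⟨ s≤s (+-monoˡ-≤ r x+len≤r) ⟩
    suc (r + r)                     ∎
    where open ≤-Reasoning
  indecomposable : Indecomposable (x ∷ x ∷ ys ++ ones r) (x + length (x ∷ ys ++ ones r))
  indecomposable u v 1≤u 1≤v u∈S v∈S u+v≡t =
    <⇒≱ (m<n∧m<o⇒1+m+m<n+o (positiveElement>r (ones-gaps x (x ∷ ys) r) 1≤u u∈S)
                            (positiveElement>r (ones-gaps x (x ∷ ys) r) 1≤v v∈S))
        (subst (_≤ suc (r + r)) (sym u+v≡t) t≤)

-- Adding a cell to the first row and to the first column

incrementHead : List ℕ → List ℕ
incrementHead []       = []
incrementHead (x ∷ xs) = suc x ∷ xs

extendFirstRowAndColumn : List ℕ → List ℕ
extendFirstRowAndColumn λs = incrementHead λs ∷ʳ 1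

incrementHead-injective : ∀ {xs ys} → incrementHead xs ≡ incrementHead ys → xs ≡ ys
incrementHead-injective {[]}    {[]}    _    = refl
incrementHead-injective {_ ∷ _} {_ ∷ _} refl = refl

extendFirstRowAndColumn-injective : ∀ {xs ys} →
  extendFirstRowAndColumn xs ≡ extendFirstRowAndColumn ys → xs ≡ ys
extendFirstRowAndColumn-injective e = incrementHead-injective (∷ʳ-injectiveˡ _ _ e)

extendFirstRowAndColumn-ones : ∀ x ys r →
  extendFirstRowAndColumn (x ∷ ys ++ ones r) ≡ suc x ∷ ys ++ ones (suc r)
extendFirstRowAndColumn-ones x ys r = cong (suc x ∷_) (++-ones-∷ʳ ys r)

Linked-incrementHead : ∀ {x ys} → Linked _≥_ (x ∷ ys) → Linked _≥_ (suc x ∷ ys)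
Linked-incrementHead [-]        = [-]
Linked-incrementHead (y≤x ∷ lk) = m≤n⇒m≤1+n y≤x ∷ lk

incrementHead-onesFree : ∀ {N x ys} → OnesFreePartition N (x ∷ ys) →
                         OnesFreePartition (suc N) (suc x ∷ ys)
incrementHead-onesFree (2≤x ∷ ps , lk , sum≡) =
  m≤n⇒m≤1+n 2≤x ∷ ps , Linked-incrementHead lk , cong suc sum≡

¬firstTwoEqual-incrementHead : ∀ {x ys} → Linked _≥_ (x ∷ ys) → ¬ FirstTwoEqual (suc x ∷ ys)
¬firstTwoEqual-incrementHead (y≤x ∷ _) 1+x≡y = 1+n≰n (subst (_≤ _) (sym 1+x≡y) y≤x)

firstTwoEqual⊎decrementHead : ∀ {N x ys} → 2 ≤ N → OnesFreePartition (suc N) (suc x ∷ ys) →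
                              FirstTwoEqual (suc x ∷ ys) ⊎ OnesFreePartition N (x ∷ ys)
firstTwoEqual⊎decrementHead {N} {x} {[]} 2≤N (_ , _ , 1+x+0≡1+N) = inj₂ (2≤x ∷ [] , [-] , x+0≡N)
  where
  x+0≡N : x + 0 ≡ N
  x+0≡N = suc-injective 1+x+0≡1+N
  2≤x : 2 ≤ x
  2≤x = subst (2 ≤_) (trans (sym x+0≡N) (+-identityʳ x)) 2≤N
firstTwoEqual⊎decrementHead {x = x} {y ∷ _} _ (_ ∷ 2≤y ∷ ps , y≤1+x ∷ lk , sum≡) with suc x ≟ y
... | yes 1+x≡y = inj₁ 1+x≡y
... | no 1+x≢y  = inj₂ (≤-trans 2≤y y≤x ∷ 2≤y ∷ ps , y≤x ∷ lk , suc-injective sum≡)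
  where
  y≤x : y ≤ x
  y≤x = ≤-pred (≤∧≢⇒< y≤1+x (1+x≢y ∘ sym))

firstHook-∷ʳ : ∀ x W → x + length (W ∷ʳ 1) ≡ suc (x + length W)
firstHook-∷ʳ x W = trans (cong (x +_) (trans (length-++ W) (+-comm (length W) 1))) (+-suc x (length W))

firstColHooks-extend : ∀ x W →
  firstColHooks (suc x ∷ W ∷ʳ 1) ≡ suc (suc (x + length W)) ∷ map suc (firstColHooks W) ∷ʳ 1
firstColHooks-extend x W = cong₂ _∷_ (cong suc (firstHook-∷ʳ x W)) (firstColHooks-∷ʳ W)

module _ (x : ℕ) (W : List ℕ) where

  private
    t : ℕ
    t = x + length W

    1∈extended : 1 ∈ firstColHooks (suc x ∷ W ∷ʳ 1)
    1∈extended rewrite firstColHooks-extend x W = there (∈-++⁺ʳ _ (here refl))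

    suc∈extended : ∀ {z} → z ∈ firstColHooks W → suc z ∈ firstColHooks (suc x ∷ W ∷ʳ 1)
    suc∈extended z∈ rewrite firstColHooks-extend x W = there (∈-++⁺ˡ (∈-map⁺ suc z∈))

    suc∈extended⁻ : ∀ {z} → suc z ∈ firstColHooks (suc x ∷ W ∷ʳ 1) →
                    z ≡ suc t ⊎ z ∈ firstColHooks W ⊎ z ≡ 0
    suc∈extended⁻ z∈ rewrite firstColHooks-extend x W with z∈
    ... | here 1+z≡2+t = inj₁ (suc-injective 1+z≡2+t)
    ... | there z∈′ with ∈-++⁻ (map suc (firstColHooks W)) z∈′
    ...   | inj₂ (here 1+z≡1) = inj₂ (inj₂ (suc-injective 1+z≡1))
    ...   | inj₁ z∈map with ∈-map⁻ suc z∈map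
    ...     | w , w∈ , refl = inj₂ (inj₁ w∈)

    corner : suc x + length (W ∷ʳ 1) ≡ suc (suc t)
    corner = cong suc (firstHook-∷ʳ x W)

  indecomposable-extend : Indecomposable (x ∷ W) t
                        ⇔ Indecomposable (suc x ∷ W ∷ʳ 1) (suc x + length (W ∷ʳ 1))
  indecomposable-extend = mk⇔ grow shrink
    where
    drop : ∀ {u v} → suc u + suc v ≡ t → suc (suc u) ∈S[ suc x ∷ W ∷ʳ 1 ] → suc u ∈S[ x ∷ W ]
    drop e _   (here 1+u≡t) = m+1+n≢m _ (trans e (sym 1+u≡t))
    drop _ u∈S (there u∈)   = u∈S (suc∈extended u∈)

    lift : ∀ {u} → 1 ≤ u → u ≤ t → u ∈S[ x ∷ W ] → suc u ∈S[ suc x ∷ W ∷ʳ 1 ]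
    lift 1≤u u≤t u∈S 1+u∈ with suc∈extended⁻ 1+u∈
    ... | inj₁ u≡1+t        = 1+n≰n (subst (_≤ t) u≡1+t u≤t)
    ... | inj₂ (inj₁ u∈)    = u∈S (there u∈)
    ... | inj₂ (inj₂ refl)  = n≮0 1≤u

    grow : Indecomposable (x ∷ W) t → Indecomposable (suc x ∷ W ∷ʳ 1) (suc x + length (W ∷ʳ 1))
    grow _     (suc zero) _ _ _ 1∈S _ _ = 1∈S 1∈extended
    grow _     (suc (suc u)) (suc zero) _ _ _ 1∈S _ = 1∈S 1∈extended
    grow indec (suc (suc u)) (suc (suc v)) _ _ u∈S v∈S e =
      indec (suc u) (suc v) (s≤s z≤n) (s≤s z≤n)
        (drop e′ u∈S) (drop (trans (+-comm (suc v) (suc u)) e′) v∈S) e′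
      where
      e′ : suc u + suc v ≡ t
      e′ = suc-injective (suc-injective (trans (cong (suc ∘ suc) (sym (+-suc u (suc v)))) (trans e corner)))

    shrink : Indecomposable (suc x ∷ W ∷ʳ 1) (suc x + length (W ∷ʳ 1)) → Indecomposable (x ∷ W) t
    shrink indec u v 1≤u 1≤v u∈S v∈S u+v≡t =
      indec (suc u) (suc v) (s≤s z≤n) (s≤s z≤n)
        (lift 1≤u (subst (u ≤_) u+v≡t (m≤m+n u v)) u∈S)
        (lift 1≤v (subst (v ≤_) u+v≡t (m≤n+m v u)) v∈S)
        (trans (cong suc (trans (+-suc u v) (cong suc u+v≡t))) (sym corner))

isSemigroup-extend : ∀ {N x ys r} → OnesFreePartition N (x ∷ ys) → N ≤ suc (suc (r + r)) →
  IsSemigroupPartition (x ∷ ys ++ ones r) ⇔ IsSemigroupPartition (suc x ∷ ys ++ ones (suc r))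
isSemigroup-extend {N} {x} {ys} {r} μ-part N≤ =
  ⇔-sym (isSemigroup⇔indecomposable (incrementHead-onesFree μ-part) 1+N≤)
    ⇔-∘ (indecomposable-extended ⇔-∘ isSemigroup⇔indecomposable μ-part N≤)
  where
  indecomposable-extended : Indecomposable (x ∷ ys ++ ones r) (x + length (ys ++ ones r))
                          ⇔ Indecomposable (suc x ∷ ys ++ ones (suc r)) (suc x + length (ys ++ ones (suc r)))
  indecomposable-extended =
    subst (λ W → Indecomposable (x ∷ ys ++ ones r) (x + length (ys ++ ones r))
                 ⇔ Indecomposable (suc x ∷ W) (suc x + length W))
          (++-ones-∷ʳ ys r) (indecomposable-extend x (ys ++ ones r))
  1+N≤ : suc N ≤ suc (suc (suc r + suc r))
  1+N≤ = s≤s (≤-trans N≤ (s≤s (s≤s (+-monoʳ-≤ r (n≤1+n r)))))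

PMPred-extendFirstRowAndColumn : ∀ {N r λs} → 1 ≤ N → N ≤ suc (suc (r + r)) →
  PMPred (N + r) (suc r) λs → PMPred (suc N + suc r) (suc (suc r)) (extendFirstRowAndColumn λs)
PMPred-extendFirstRowAndColumn {N} {r} 1≤N N≤ pm with PMPred⇒onesSplit {N} {r} pm
... | [] , (_ , _ , refl) , _ = contradiction 1≤N λ ()
... | x ∷ ys , μ-part , refl =
  subst (PMPred (suc N + suc r) (suc (suc r))) (sym (extendFirstRowAndColumn-ones x ys r))
    (onesSplit⇒PMPred {r = suc r} (incrementHead-onesFree μ-part)
      (Equivalence.to (isSemigroup-extend {r = r} μ-part N≤) (proj₂ (proj₂ pm))))

AbarPred⇒PMPred-++-ones : ∀ {N r μ} → N ≤ suc (suc (r + r)) → AbarPred (suc N) μ →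
                          PMPred (suc N + suc r) (suc (suc r)) (μ ++ ones (suc r))
AbarPred⇒PMPred-++-ones {r = r} {x ∷ _ ∷ _} N≤ ((_ , lk , sum≡) , _ , ps , refl) =
  onesSplit⇒PMPred (ps , lk , sum≡)
    (doubledHead-isSemigroup (ps , lk , sum≡) (s≤s (≤-trans N≤ (≤-reflexive (sym (cong suc (+-suc r r)))))))

onesFree∧firstTwoEqual⇒AbarPred : ∀ {N μ} → OnesFreePartition N μ → FirstTwoEqual μ → AbarPred N μ
onesFree∧firstTwoEqual⇒AbarPred {μ = _ ∷ _ ∷ _} (ps , lk , sum≡) eq =
  (All.map <⇒≤ ps , lk , sum≡) , s≤s (s≤s z≤n) , ps , eq

PMPred-cases : ∀ {N r λs} → 2 ≤ N → N ≤ suc (suc (r + r)) →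
  PMPred (suc N + suc r) (suc (suc r)) λs →
  (∃ λ λ′ → PMPred (N + r) (suc r) λ′ × λs ≡ extendFirstRowAndColumn λ′) ⊎
  (∃ λ μ → AbarPred (suc N) μ × λs ≡ μ ++ ones (suc r))
PMPred-cases {N} {r} 2≤N N≤ pm with PMPred⇒onesSplit {suc N} {suc r} pm
... | [] , (_ , _ , ()) , _
... | zero ∷ _ , (() ∷ _ , _) , _
... | suc x ∷ ys , μ-part , refl with firstTwoEqual⊎decrementHead 2≤N μ-part
...   | inj₁ firstTwoEqual = inj₂ (_ , onesFree∧firstTwoEqual⇒AbarPred μ-part firstTwoEqual , refl)
...   | inj₂ μ′-part = inj₁ (x ∷ ys ++ ones r ,
        onesSplit⇒PMPred μ′-part (Equivalence.from (isSemigroup-extend μ′-part N≤) (proj₂ (proj₂ pm))) ,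
        sym (extendFirstRowAndColumn-ones x ys r))

extendFirstRowAndColumn≢++-ones : ∀ {N r λs μ} → 1 ≤ N → PMPred (N + r) (suc r) λs →
  AbarPred (suc N) μ → extendFirstRowAndColumn λs ≢ μ ++ ones (suc r)
extendFirstRowAndColumn≢++-ones {N} {r} 1≤N pm abar e with PMPred⇒onesSplit {N} {r} pm
... | [] , (_ , _ , refl) , _ = contradiction 1≤N λ ()
... | x ∷ ys , (_ , lk , _) , refl
  with ++-cancelʳ (ones (suc r)) (suc x ∷ ys) _ (trans (sym (extendFirstRowAndColumn-ones x ys r)) e)
...   | refl = ¬firstTwoEqual-incrementHead lk (proj₂ (proj₂ (proj₂ abar)))

2j+2≤n⇒n≡2+j+p : ∀ {j n} → 2 * j + 2 ≤ n → ∃ λ p → j ≤ p × suc (suc (j + p)) ≡ n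
2j+2≤n⇒n≡2+j+p {j} 2j+2≤n with m≤n⇒∃[o]m+o≡n 2j+2≤n
... | k , 2j+2+k≡n = j + k , m≤m+n j k ,
  trans (solve 2 (λ j k → con 2 :+ (j :+ (j :+ k)) := con 2 :* j :+ con 2 :+ k) refl j k) 2j+2+k≡n
  where open +-*-Solver

PM-recurrence : ∀ {N r a b c} → 2 ≤ N → N ≤ suc (suc (r + r)) →
  HasCount (PMPred (suc N + suc r) (suc (suc r))) a →
  HasCount (PMPred (N + r) (suc r)) b →
  HasCount (AbarPred (suc N)) c →
  a ≡ b + c
PM-recurrence {r = r} 2≤N N≤ = count-disjointUnion
  extendFirstRowAndColumn-injective (λ {x} {y} → ++-cancelʳ (ones (suc r)) x y)
  (extendFirstRowAndColumn≢++-ones (<⇒≤ 2≤N))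
  (PMPred-extendFirstRowAndColumn (<⇒≤ 2≤N) N≤) (AbarPred⇒PMPred-++-ones N≤)
  (PMPred-cases 2≤N N≤)

theorem5p5 : (j n : ℕ) → 2 * j + 2 ≤ n →
    (a b c : ℕ) →
    HasCount (PMPred (2 * n ∸ j) (n ∸ j)) a →
    HasCount (PMPred (2 * (n ∸ 1) ∸ j) ((n ∸ 1) ∸ j)) b →
    HasCount (AbarPred (n + 1)) c →
    a ≡ b + c
theorem5p5 j n 2j+2≤n a b c hA hB hC with 2j+2≤n⇒n≡2+j+p {j} 2j+2≤n
... | p , j≤p , refl =
  PM-recurrence {N = suc (suc (j + p))} {r = p} (s≤s (s≤s z≤n)) (s≤s (s≤s (+-monoˡ-≤ p j≤p)))
    (subst₂ (λ m r → HasCount (PMPred m r) a) A-size A-ones hA)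
    (subst₂ (λ m r → HasCount (PMPred m r) b) B-size B-ones hB)
    (subst (λ m → HasCount (AbarPred m) c) (+-comm _ 1) hC)
  where
  open +-*-Solver
  ∸j : ∀ {m l} → m ≡ j + l → m ∸ j ≡ l
  ∸j {l = l} m≡j+l = trans (cong (_∸ j) m≡j+l) (m+n∸m≡n j l)
  A-size : 2 * suc (suc (j + p)) ∸ j ≡ suc (suc (suc (j + p))) + suc p
  A-size = ∸j (solve 2 (λ j p → con 2 :* (con 2 :+ (j :+ p)) := j :+ ((con 3 :+ (j :+ p)) :+ (con 1 :+ p)))
                      refl j p)
  A-ones : suc (suc (j + p)) ∸ j ≡ suc (suc p)
  A-ones = ∸j (solve 2 (λ j p → con 2 :+ (j :+ p) := j :+ (con 2 :+ p)) refl j p)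
  B-size : 2 * suc (j + p) ∸ j ≡ suc (suc (j + p)) + p
  B-size = ∸j (solve 2 (λ j p → con 2 :* (con 1 :+ (j :+ p)) := j :+ ((con 2 :+ (j :+ p)) :+ p))
                      refl j p)
  B-ones : suc (j + p) ∸ j ≡ suc p
  B-ones = ∸j (sym (+-suc j p))
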